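{- Let $n\ge 4$ be an integer and set $d=(n-1)^3$. If $k$ is a positive integer satisfying $$\binom{(k-1)-\lfloor \frac{d}{2}\rfloor-1}{\lfloor\frac{d-1}{2}\rfloor}+\binom{(k-1)-\lfloor \frac{d-1}{2}\rfloor-1}{\lfloor\frac{d}{2}\rfloor}<n^3\leq \binom{k-\lfloor \frac{d}{2}\rfloor-1}{\lfloor\frac{d-1}{2}\rfloor}+\binom{k-\lfloor \frac{d-1}{2}\rfloor-1}{\lfloor\frac{d}{2}\rfloor},$$ then $k=(n-1)^3+2$. -}

module Defs where

open import Data.Nat using (ℕ; _+_; _∸_; _/_; _^_)
open import Data.Nat.Combinatorics using (_C_)

-- S d k = C(k - ⌊d/2⌋ - 1, ⌊(d-1)/2⌋) + C(k - ⌊(d-1)/2⌋ - 1, ⌊d/2⌋)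
-- (truncated subtraction; top arguments that would be negative give 0,
--  which is the combinatorial convention since the bottom arguments are ≥ 1 here)
S : ℕ → ℕ → ℕ
S d k = ((k ∸ (d / 2) ∸ 1) C ((d ∸ 1) / 2)) + ((k ∸ ((d ∸ 1) / 2) ∸ 1) C (d / 2))

-- Put a = ⌊d/2⌋ and b = ⌊(d-1)/2⌋, so that a + b = d - 1 for d ≥ 1.  The sum S d k
-- is monotone in k, and on the two values k = d + 1, d + 2 it is
--   S d (d + 1) = C(b+1, b) + C(a+1, a) = d + 1 < n³,
--   S d (d + 2) ≥ C(a+2, 2) ≥ d²/8 = (n-1)⁶/8 ≥ n³   (as n ≥ 4).
-- The right inequality of the hypothesis therefore forces k ≥ d + 2 and the left
-- one forces k - 1 < d + 2.
module Submission where

open import Defs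
open import Data.Nat using (ℕ; zero; suc; _+_; _*_; _∸_; _/_; _^_; _≤_; _<_; _≤′_; ≤′-refl; ≤′-step; z≤n; s≤s)
open import Data.Nat.Properties
open import Data.Nat.DivMod using (m/n≡1+[m∸n]/n; /-monoˡ-≤)
open import Data.Nat.Combinatorics using (_C_; nCk≡nC[n∸k]; nC1≡n; nCk+nC[k+1]≡[n+1]C[k+1])
open import Data.Nat.Solver using (module +-*-Solver)
open +-*-Solver using (solve; _:=_; _:+_; _:*_; _:^_; con)
open import Relation.Binary.PropositionalEquality using (_≡_; refl; sym; trans; cong; cong₂; subst; module ≡-Reasoning)
open import Algebra.Properties.CommutativeSemigroup +-commutativeSemigroup using (x∙yz≈y∙xz)

C-monoˡ-≤ : ∀ k {m n} → m ≤ n → m C k ≤ n C k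
C-monoˡ-≤ k m≤n = go (≤⇒≤′ m≤n)
  where
  step : ∀ k n → n C k ≤ suc n C k
  step zero    n = ≤-refl
  step (suc j) n = subst (n C suc j ≤_) (nCk+nC[k+1]≡[n+1]C[k+1] n j) (m≤n+m _ _)

  go : ∀ {m n} → m ≤′ n → m C k ≤ n C k
  go ≤′-refl        = ≤-refl
  go (≤′-step m≤′n) = ≤-trans (go m≤′n) (step k _)

[k+n]Cn≡[k+n]Ck : ∀ k n → (k + n) C n ≡ (k + n) C k
[k+n]Cn≡[k+n]Ck k n = trans (nCk≡nC[n∸k] (m≤n+m n k)) (cong ((k + n) C_) (m+n∸n≡m k n))

[1+n]Cn≡1+n : ∀ n → suc n C n ≡ suc n
[1+n]Cn≡1+n n = trans ([k+n]Cn≡[k+n]Ck 1 n) (nC1≡n (suc n))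

2*[1+n]C2≡[1+n]*n : ∀ n → 2 * (suc n C 2) ≡ suc n * n
2*[1+n]C2≡[1+n]*n zero    = refl
2*[1+n]C2≡[1+n]*n (suc n) = begin
  2 * (suc (suc n) C 2)         ≡⟨ cong (2 *_) (sym (nCk+nC[k+1]≡[n+1]C[k+1] (suc n) 1)) ⟩
  2 * (suc n C 1 + suc n C 2)   ≡⟨ cong (λ c → 2 * (c + suc n C 2)) (nC1≡n (suc n)) ⟩
  2 * (suc n + suc n C 2)       ≡⟨ *-distribˡ-+ 2 (suc n) (suc n C 2) ⟩
  2 * suc n + 2 * (suc n C 2)   ≡⟨ cong (2 * suc n +_) (2*[1+n]C2≡[1+n]*n n) ⟩
  2 * suc n + suc n * n         ≡⟨ cong (2 * suc n +_) (*-comm (suc n) n) ⟩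
  2 * suc n + n * suc n         ≡⟨ *-distribʳ-+ (suc n) 2 n ⟨
  suc (suc n) * suc n           ∎
  where open ≡-Reasoning

[1+m]/2+m/2≡m : ∀ m → suc m / 2 + m / 2 ≡ m
[1+m]/2+m/2≡m zero          = refl
[1+m]/2+m/2≡m (suc zero)    = refl
[1+m]/2+m/2≡m (suc (suc m)) = begin
  suc (suc (suc m)) / 2 + suc (suc m) / 2  ≡⟨ cong₂ _+_ (half (suc m)) (half m) ⟩
  suc (suc m / 2) + suc (m / 2)           ≡⟨ cong suc (+-suc (suc m / 2) (m / 2)) ⟩
  suc (suc (suc m / 2 + m / 2))           ≡⟨ cong (λ x → suc (suc x)) ([1+m]/2+m/2≡m m) ⟩
  suc (suc m)                             ∎
  where
  open ≡-Reasoning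
  half : ∀ n → suc (suc n) / 2 ≡ suc (n / 2)
  half n = m/n≡1+[m∸n]/n {suc (suc n)} (s≤s (s≤s z≤n))

[1+m+n]∸m∸1≡n : ∀ m n → suc (m + n) ∸ m ∸ 1 ≡ n
[1+m+n]∸m∸1≡n zero    n = refl
[1+m+n]∸m∸1≡n (suc m) n = [1+m+n]∸m∸1≡n m n

pairedBinomial : ℕ → ℕ → ℕ → ℕ
pairedBinomial a b k = (k ∸ a ∸ 1) C b + (k ∸ b ∸ 1) C a

pairedBinomial-monoʳ-≤ : ∀ a b {k l} → k ≤ l → pairedBinomial a b k ≤ pairedBinomial a b l
pairedBinomial-monoʳ-≤ a b k≤l =
  +-mono-≤ (C-monoˡ-≤ b (∸-monoˡ-≤ 1 (∸-monoˡ-≤ a k≤l)))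
           (C-monoˡ-≤ a (∸-monoˡ-≤ 1 (∸-monoˡ-≤ b k≤l)))

pairedBinomial-[1+c+a+b] : ∀ a b c →
  pairedBinomial a b (suc (c + (a + b))) ≡ (c + b) C b + (c + a) C a
pairedBinomial-[1+c+a+b] a b c = cong₂ _+_ (cong (_C b) first) (cong (_C a) second)
  where
  first : suc (c + (a + b)) ∸ a ∸ 1 ≡ c + b
  first = trans (cong (λ x → suc x ∸ a ∸ 1) (x∙yz≈y∙xz c a b)) ([1+m+n]∸m∸1≡n a (c + b))

  second : suc (c + (a + b)) ∸ b ∸ 1 ≡ c + a
  second = trans (cong (λ x → suc x ∸ b ∸ 1) (trans (cong (c +_) (+-comm a b)) (x∙yz≈y∙xz c b a)))
                 ([1+m+n]∸m∸1≡n b (c + a))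

pairedBinomial-[2+a+b] : ∀ a b → pairedBinomial a b (2 + (a + b)) ≡ 2 + (a + b)
pairedBinomial-[2+a+b] a b = begin
  pairedBinomial a b (2 + (a + b))  ≡⟨ pairedBinomial-[1+c+a+b] a b 1 ⟩
  suc b C b + suc a C a            ≡⟨ cong₂ _+_ ([1+n]Cn≡1+n b) ([1+n]Cn≡1+n a) ⟩
  suc b + suc a                    ≡⟨ cong suc (trans (+-suc b a) (cong suc (+-comm b a))) ⟩
  2 + (a + b)                      ∎
  where open ≡-Reasoning

[2+a]C2≤pairedBinomial-[3+a+b] : ∀ a b → (2 + a) C 2 ≤ pairedBinomial a b (3 + (a + b))
[2+a]C2≤pairedBinomial-[3+a+b] a b = begin
  (2 + a) C 2                            ≡⟨ [k+n]Cn≡[k+n]Ck 2 a ⟨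
  (2 + a) C a                            ≤⟨ m≤n+m _ _ ⟩
  (2 + b) C b + (2 + a) C a              ≡⟨ pairedBinomial-[1+c+a+b] a b 2 ⟨
  pairedBinomial a b (3 + (a + b))       ∎
  where open ≤-Reasoning

S-cancelʳ-< : ∀ d {k l} → S d k < S d l → k < l
S-cancelʳ-< d S[k]<S[l] =
  ≰⇒> (λ l≤k → <⇒≱ S[k]<S[l] (pairedBinomial-monoʳ-≤ (d / 2) ((d ∸ 1) / 2) l≤k))

S-suc-self : ∀ {d} → 1 ≤ d → S d (suc d) ≡ suc d
S-suc-self {suc m} (s≤s z≤n) =
  subst (λ x → pairedBinomial a b (2 + x) ≡ 2 + x) ([1+m]/2+m/2≡m m) (pairedBinomial-[2+a+b] a b)
  where
  a = suc m / 2
  b = m / 2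

d*d≤8*S[d,2+d] : ∀ d → d * d ≤ 8 * S d (2 + d)
d*d≤8*S[d,2+d] zero    = z≤n
d*d≤8*S[d,2+d] (suc m) = begin
  suc m * suc m                  ≤⟨ *-mono-≤ 1+m≤u 1+m≤u ⟩
  u * u                          ≤⟨ m≤m+n (u * u) (2 * u) ⟩
  u * u + 2 * u                  ≡⟨ quadratic a ⟨
  4 * ((2 + a) * (1 + a))        ≡⟨ cong (4 *_) (2*[1+n]C2≡[1+n]*n (suc a)) ⟨
  4 * (2 * ((2 + a) C 2))        ≡⟨ *-assoc 4 2 ((2 + a) C 2) ⟨
  8 * ((2 + a) C 2)              ≤⟨ *-monoʳ-≤ 8 C≤S ⟩
  8 * S (suc m) (3 + m)          ∎
  where
  open ≤-Reasoning
  a = suc m / 2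
  b = m / 2
  u = suc a + suc a

  1+m≤u : suc m ≤ u
  1+m≤u = begin
    suc m          ≡⟨ cong suc ([1+m]/2+m/2≡m m) ⟨
    suc a + b      ≤⟨ +-monoʳ-≤ (suc a) (≤-trans (/-monoˡ-≤ 2 (n≤1+n m)) (n≤1+n a)) ⟩
    u              ∎

  quadratic : ∀ x → 4 * ((2 + x) * (1 + x)) ≡ (suc x + suc x) * (suc x + suc x) + 2 * (suc x + suc x)
  quadratic = solve 1 (λ x → con 4 :* ((con 2 :+ x) :* (con 1 :+ x))
                        := ((con 1 :+ x) :+ (con 1 :+ x)) :* ((con 1 :+ x) :+ (con 1 :+ x))
                           :+ con 2 :* ((con 1 :+ x) :+ (con 1 :+ x))) refl

  C≤S : (2 + a) C 2 ≤ S (suc m) (3 + m)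
  C≤S = subst (λ x → (2 + a) C 2 ≤ pairedBinomial a b (3 + x)) ([1+m]/2+m/2≡m m)
              ([2+a]C2≤pairedBinomial-[3+a+b] a b)

[m*n]^3≡m^3*n^3 : ∀ m n → (m * n) ^ 3 ≡ m ^ 3 * n ^ 3
[m*n]^3≡m^3*n^3 = solve 2 (λ m n → (m :* n) :^ 3 := m :^ 3 :* n :^ 3) refl

2+m^3≤[1+m]^3 : ∀ {m} → 1 ≤ m → 2 + m ^ 3 ≤ suc m ^ 3
2+m^3≤[1+m]^3 {suc i} _ = subst (2 + suc i ^ 3 ≤_) (sym (expand i)) (m≤m+n _ _)
  where
  expand : ∀ i → (2 + i) ^ 3 ≡ (2 + (1 + i) ^ 3) + (5 + i * (9 + 3 * i))
  expand = solve 1 (λ i → (con 2 :+ i) :^ 3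
                     := (con 2 :+ (con 1 :+ i) :^ 3) :+ (con 5 :+ i :* (con 9 :+ con 3 :* i))) refl

8*[1+m]^3≤m^3*m^3 : ∀ {m} → 3 ≤ m → 8 * suc m ^ 3 ≤ m ^ 3 * m ^ 3
8*[1+m]^3≤m^3*m^3 {m} 3≤m = begin
  8 * suc m ^ 3       ≡⟨ [m*n]^3≡m^3*n^3 2 (suc m) ⟨
  (2 * suc m) ^ 3     ≤⟨ ^-monoˡ-≤ 3 2[1+m]≤3m ⟩
  (3 * m) ^ 3         ≡⟨ [m*n]^3≡m^3*n^3 3 m ⟩
  27 * m ^ 3          ≤⟨ *-monoˡ-≤ (m ^ 3) (^-monoˡ-≤ 3 3≤m) ⟩
  m ^ 3 * m ^ 3       ∎
  where
  open ≤-Reasoning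
  2[1+m]≤3m : 2 * suc m ≤ 3 * m
  2[1+m]≤3m = subst (_≤ 3 * m) (sym (*-suc 2 m)) (+-monoˡ-≤ (2 * m) (≤-trans (n≤1+n 2) 3≤m))

proposition6 : (n k : ℕ) → 4 ≤ n → 1 ≤ k →
    S ((n ∸ 1) ^ 3) (k ∸ 1) < n ^ 3 →
    n ^ 3 ≤ S ((n ∸ 1) ^ 3) k →
    k ≡ (n ∸ 1) ^ 3 + 2
proposition6 (suc m) (suc k) (s≤s 3≤m) (s≤s z≤n) S[k]<n³ n³≤S[1+k] =
  trans (≤-antisym 1+k≤2+d 2+d≤1+k) (+-comm 2 d)
  where
  open ≤-Reasoning
  d = m ^ 3

  n³≤S[2+d] : suc m ^ 3 ≤ S d (2 + d)
  n³≤S[2+d] = *-cancelˡ-≤ 8 (≤-trans (8*[1+m]^3≤m^3*m^3 3≤m) (d*d≤8*S[d,2+d] d))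

  2+d≤1+k : 2 + d ≤ suc k
  2+d≤1+k = S-cancelʳ-< d (begin-strict
    S d (suc d)  ≡⟨ S-suc-self (≤-trans (s≤s z≤n) (^-monoˡ-≤ 3 3≤m)) ⟩
    suc d        <⟨ 2+m^3≤[1+m]^3 (≤-trans (s≤s z≤n) 3≤m) ⟩
    suc m ^ 3    ≤⟨ n³≤S[1+k] ⟩
    S d (suc k)  ∎)

  1+k≤2+d : suc k ≤ 2 + d
  1+k≤2+d = S-cancelʳ-< d (<-≤-trans S[k]<n³ n³≤S[2+d])
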